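{- Let $D$ be a minimal counterexample to the conjecture described in the context, and let $x$ be a vertex of $D$ none of whose incident edges is green. Then no vertex of $D$ monochromatically dominates $x$ both in red and in blue, and $x$ does not monochromatically dominate any vertex both in red and in blue.
   Context: A 3-coloured tournament is a finite tournament each of whose edges is coloured red, blue or green. A triple of vertices spans a $T_3$ if the three edges between them form a directed cycle with three distinct colours. For distinct vertices $x,y$, $x$ monochromatically dominates $y$ in colour $c$ if there is a directed path from $x$ to $y$ all of whose edges have colour $c$. The conjecture: every 3-coloured tournament has a triple spanning a $T_3$ or a vertex monochromatically dominating every other vertex. A minimal counterexample is a 3-coloured tournament $D$ with no $T_3$ and no vertex dominating all others, such that every proper nonempty subtournament has a $T_3$ or a vertex monochromatically dominating all its other vertices within it. -}

module Defs where

open import Data.Nat using (ℕ)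
open import Data.Fin using (Fin)
open import Data.Bool using (Bool; true; false)
open import Data.Product using (Σ; ∃; ∃-syntax; _×_; _,_)
open import Data.Sum using (_⊎_)
open import Relation.Nullary using (¬_)
open import Relation.Binary.PropositionalEquality using (_≡_; _≢_)

data Colour : Set where
  red blue green : Colour

-- A 3-coloured tournament on the vertex set Fin n.
-- arc x y ≡ true means the edge between x and y is directed from x to y;
-- col x y is the colour of that edge (only consulted when arc x y ≡ true).
record Tournament3 (n : ℕ) : Set where
  field
    arc     : Fin n → Fin n → Bool
    col     : Fin n → Fin n → Colour
    irrefl  : ∀ x → arc x x ≡ false
    total   : ∀ x y → x ≢ y → arc x y ≡ true ⊎ arc y x ≡ true
    antisym : ∀ x y → arc x y ≡ true → arc y x ≡ false

module _ {n : ℕ} (D : Tournament3 n) where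
  open Tournament3 D

  VSet : Set
  VSet = Fin n → Bool

  _∈ₛ_ : Fin n → VSet → Set
  v ∈ₛ S = S v ≡ true

  full : VSet
  full _ = true

  data MonoPath (S : VSet) (c : Colour) : Fin n → Fin n → Set where
    edge : ∀ {x y} → x ∈ₛ S → y ∈ₛ S → arc x y ≡ true → col x y ≡ c →
           MonoPath S c x y
    step : ∀ {x y z} → x ∈ₛ S → y ∈ₛ S → arc x y ≡ true → col x y ≡ c →
           MonoPath S c y z → MonoPath S c x z

  MonoDom : VSet → Fin n → Fin n → Set
  MonoDom S x y = ∃[ c ] MonoPath S c x y

  HasT3 : VSet → Set
  HasT3 S = ∃[ x ] ∃[ y ] ∃[ z ]
    (x ∈ₛ S × y ∈ₛ S × z ∈ₛ S ×
     arc x y ≡ true × arc y z ≡ true × arc z x ≡ true ×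
     col x y ≢ col y z × col y z ≢ col z x × col z x ≢ col x y)

  HasDominator : VSet → Set
  HasDominator S = ∃[ x ] (x ∈ₛ S × (∀ y → y ∈ₛ S → y ≢ x → MonoDom S x y))

  Good : VSet → Set
  Good S = HasT3 S ⊎ HasDominator S

  MinimalCounterexample : Set
  MinimalCounterexample =
    ¬ Good full ×
    (∀ (S : VSet) → (∃[ v ] v ∈ₛ S) → (∃[ v ] ¬ (v ∈ₛ S)) → Good S)

  NoGreenAt : Fin n → Set
  NoGreenAt x = (∀ y → arc x y ≡ true → col x y ≢ green) ×
                (∀ y → arc y x ≡ true → col y x ≢ green)

module Submission where

-- Since D has no T3, neither has any D − v, so by minimality every D − v
-- (for D with at least two vertices) has a dominator δ v ≠ v.  Then δ v
-- does not dominate v in D, for otherwise it would dominate all of D.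
-- Consequently δ is injective (if δ a = δ b with a ≠ b, then δ b dominates
-- a, i.e. δ a dominates a), hence a permutation of the finite vertex set.
--
-- A red path and a blue path from y to x can be continued by any
-- monochromatic path leaving x, since that path is red or blue; dually for
-- paths into x.  So:
--  * if y reaches x in red and blue, pick b, a with δ b = y and δ a = x;
--    then x dominates b, hence so does y = δ b, which is impossible;
--  * if x reaches y in red and blue, then δ y dominates x, hence y,
--    which is impossible.

open import Defs
open import Data.Nat using (ℕ; suc)
open import Data.Nat.Properties using (1+n≰n)
open import Data.Fin using (Fin; punchOut)
open import Data.Fin.Properties using (_≟_; any?; punchOut-injective; injective⇒≤)
open import Data.Bool using (true; false)
open import Data.Product using (∃-syntax; _×_; _,_; proj₁; proj₂)
open import Data.Sum using (inj₁; inj₂)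
open import Data.Empty using (⊥-elim)
open import Function.Definitions using (Injective)
open import Relation.Nullary using (¬_; yes; no)
open import Relation.Nullary.Decidable using (¬?)
open import Relation.Binary.PropositionalEquality
  using (_≡_; _≢_; refl; sym; trans; cong; subst)

-- An injective endofunction of a finite set is onto: otherwise, omitting a
-- missed value, it would inject Fin (suc n) into Fin n.
injective⇒onto : ∀ {n} (f : Fin n → Fin n) → Injective _≡_ _≡_ f →
                 ∀ y → ∃[ x ] f x ≡ y
injective⇒onto f f-inj y with any? (λ x → f x ≟ y)
... | yes hit = hit
injective⇒onto {suc n} f f-inj y | no miss =
  ⊥-elim (1+n≰n (injective⇒≤ {f = squeeze} squeeze-injective))
  where
  squeeze : Fin (suc n) → Fin n
  squeeze x = punchOut {i = y} (λ e → miss (x , sym e))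

  squeeze-injective : Injective _≡_ _≡_ squeeze
  squeeze-injective {a} {b} e =
    f-inj (punchOut-injective (λ e → miss (a , sym e)) (λ e → miss (b , sym e)) e)

module _ {n : ℕ} (D : Tournament3 n) where
  open Tournament3 D

  _⊆_ : VSet D → VSet D → Set
  S ⊆ T = ∀ {v} → S v ≡ true → T v ≡ true

  weaken : ∀ {S T c a b} → S ⊆ T → MonoPath D S c a b → MonoPath D T c a b
  weaken S⊆T (edge a∈ b∈ ab col≡) = edge (S⊆T a∈) (S⊆T b∈) ab col≡
  weaken S⊆T (step a∈ b∈ ab col≡ p) = step (S⊆T a∈) (S⊆T b∈) ab col≡ (weaken S⊆T p)

  _++ᵖ_ : ∀ {S c a b d} → MonoPath D S c a b → MonoPath D S c b d → MonoPath D S c a d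
  edge a∈ b∈ ab col≡ ++ᵖ q = step a∈ b∈ ab col≡ q
  step a∈ b∈ ab col≡ p ++ᵖ q = step a∈ b∈ ab col≡ (p ++ᵖ q)

  T3-lifts : ∀ {S} → HasT3 D S → HasT3 D (full D)
  T3-lifts (a , b , c , _ , _ , _ , cycle) = a , b , c , refl , refl , refl , cycle

  leaving-notGreen : ∀ {S c x b} → NoGreenAt D x → MonoPath D S c x b → c ≢ green
  leaving-notGreen (out , _) (edge _ _ xb col≡) c≡g = out _ xb (trans col≡ c≡g)
  leaving-notGreen (out , _) (step _ _ xb col≡ _) c≡g = out _ xb (trans col≡ c≡g)

  entering-notGreen : ∀ {S c a x} → NoGreenAt D x → MonoPath D S c a x → c ≢ green
  entering-notGreen (_ , inn) (edge _ _ ax col≡) c≡g = inn _ ax (trans col≡ c≡g)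
  entering-notGreen noGreen (step _ _ _ _ p) = entering-notGreen noGreen p

  red-blue-before : ∀ {S x y z} → NoGreenAt D x →
    MonoPath D S red y x → MonoPath D S blue y x → MonoDom D S x z → MonoDom D S y z
  red-blue-before _ r b (red , p) = red , r ++ᵖ p
  red-blue-before _ r b (blue , p) = blue , b ++ᵖ p
  red-blue-before noGreen r b (green , p) = ⊥-elim (leaving-notGreen noGreen p refl)

  red-blue-after : ∀ {S x y z} → NoGreenAt D x →
    MonoPath D S red x y → MonoPath D S blue x y → MonoDom D S z x → MonoDom D S z y
  red-blue-after _ r b (red , p) = red , p ++ᵖ r
  red-blue-after _ r b (blue , p) = blue , p ++ᵖ b
  red-blue-after noGreen r b (green , p) = ⊥-elim (entering-notGreen noGreen p refl)

  without : Fin n → VSet D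
  without v w with w ≟ v
  ... | yes _ = false
  ... | no _ = true

  ∉-without : ∀ v → ¬ (without v v ≡ true)
  ∉-without v v∈ with v ≟ v
  ∉-without v () | yes _
  ... | no v≢v = v≢v refl

  ∈-without : ∀ {v w} → w ≢ v → without v w ≡ true
  ∈-without {v} {w} w≢v with w ≟ v
  ... | yes w≡v = ⊥-elim (w≢v w≡v)
  ... | no _ = refl

  ∈-without⁻ : ∀ {v w} → without v w ≡ true → w ≢ v
  ∈-without⁻ {v} {w} w∈ with w ≟ v
  ∈-without⁻ {v} {w} () | yes _
  ... | no w≢v = w≢v

  module Minimal (mc : MinimalCounterexample D) where
    notGood : ¬ Good D (full D)
    notGood = proj₁ mc

    -- A one-vertex tournament has a dominator, so every vertex has a
    -- companion; in particular each D − v is nonempty.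
    companion : ∀ v → ∃[ w ] w ≢ v
    companion v with any? (λ w → ¬? (w ≟ v))
    ... | yes found = found
    ... | no none = ⊥-elim (notGood (inj₂ (v , refl , λ w _ w≢v → ⊥-elim (none (w , w≢v)))))

    deletion-dominated : ∀ v → HasDominator D (without v)
    deletion-dominated v
      with proj₂ mc (without v) (proj₁ (companion v) , ∈-without (proj₂ (companion v)))
                                (v , ∉-without v)
    ... | inj₁ t3 = ⊥-elim (notGood (inj₁ (T3-lifts t3)))
    ... | inj₂ dom = dom

    δ : Fin n → Fin n
    δ v = proj₁ (deletion-dominated v)

    δ-≢ : ∀ v → δ v ≢ v
    δ-≢ v = ∈-without⁻ (proj₁ (proj₂ (deletion-dominated v)))

    δ-dominates : ∀ {u v w} → δ v ≡ u → w ≢ v → w ≢ u → MonoDom D (full D) u w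
    δ-dominates {v = v} {w} refl w≢v w≢u
      with proj₂ (proj₂ (deletion-dominated v)) w (∈-without w≢v) w≢u
    ... | c , p = c , weaken (λ _ → refl) p

    δ-misses : ∀ {u v} → δ v ≡ u → ¬ MonoDom D (full D) u v
    δ-misses {v = v} refl u⇒v = notGood (inj₂ (δ v , refl , dominatesAll))
      where
      dominatesAll : ∀ w → full D w ≡ true → w ≢ δ v → MonoDom D (full D) (δ v) w
      dominatesAll w _ w≢u with w ≟ v
      ... | yes refl = u⇒v
      ... | no w≢v = δ-dominates refl w≢v w≢u

    δ-injective : Injective _≡_ _≡_ δ
    δ-injective {a} {b} δa≡δb with a ≟ b
    ... | yes a≡b = a≡b
    ... | no a≢b = ⊥-elim (δ-misses δa≡δb
                     (δ-dominates refl a≢b (λ a≡δb → δ-≢ a (trans δa≡δb (sym a≡δb)))))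

    δ-onto : ∀ u → ∃[ v ] δ v ≡ u
    δ-onto = injective⇒onto δ δ-injective

    no-red-blue-into : ∀ {x} → NoGreenAt D x →
      ¬ (∃[ y ] (y ≢ x × MonoPath D (full D) red y x × MonoPath D (full D) blue y x))
    no-red-blue-into {x} noGreen (y , y≢x , r , b)
      with v , δv≡y ← δ-onto y | a , δa≡x ← δ-onto x
      = δ-misses δv≡y (red-blue-before noGreen r b x⇒v)
      where
      v≢x : v ≢ x
      v≢x v≡x = δ-misses δv≡y (red , subst (MonoPath D (full D) red y) (sym v≡x) r)

      v≢a : v ≢ a
      v≢a v≡a = y≢x (trans (sym δv≡y) (trans (cong δ v≡a) δa≡x))

      x⇒v : MonoDom D (full D) x v
      x⇒v = δ-dominates δa≡x v≢a v≢x

    no-red-blue-out-of : ∀ {x} → NoGreenAt D x →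
      ¬ (∃[ y ] (y ≢ x × MonoPath D (full D) red x y × MonoPath D (full D) blue x y))
    no-red-blue-out-of {x} noGreen (y , y≢x , r , b) =
      δ-misses refl (red-blue-after noGreen r b δy⇒x)
      where
      δy≢x : δ y ≢ x
      δy≢x δy≡x = δ-misses δy≡x (red , r)

      δy⇒x : MonoDom D (full D) (δ y) x
      δy⇒x = δ-dominates refl (λ x≡y → y≢x (sym x≡y)) (λ x≡δy → δy≢x (sym x≡δy))

lemma3p2 : ∀ {n : ℕ} (D : Tournament3 n) → MinimalCounterexample D →
    ∀ (x : Fin n) → NoGreenAt D x →
    (¬ (∃[ y ] (y ≢ x × MonoPath D (full D) red y x × MonoPath D (full D) blue y x))) ×
    (¬ (∃[ y ] (y ≢ x × MonoPath D (full D) red x y × MonoPath D (full D) blue x y)))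
lemma3p2 D mc x noGreen = no-red-blue-into noGreen , no-red-blue-out-of noGreen
  where open Minimal D mc
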